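{- For every MCCS reduction $P\to Q$, the formula $\lfloor P\rfloor\multimap\lfloor Q\rfloor$ is provable in MLL (i.e. without modality rules) for some instantiation of the propositional variables of $\lfloor P\rfloor$.
   Context: MCCS terms are generated by $P,Q ::= 1 \mid P\parallel Q \mid a.P \mid \bar a.P$, with $a$ ranging over channel names. Structural congruence $\equiv$ is the smallest congruence making $\parallel$ associative and commutative with $1$ neutral. Reduction $\to$ is the relation on terms up to $\equiv$ generated by $\bar a.P\parallel a.Q\parallel R\to P\parallel Q\parallel R$. MLLa formulas: $A,B ::= \alpha \mid \alpha^\perp \mid A\otimes B \mid A⅋B \mid \mathsf{M}^+_a A \mid \mathsf{M}^-_a A$ ($\alpha$ propositional variables, $a$ channel names), with negation $(\alpha)^\perp=\alpha^\perp$, $(\alpha^\perp)^\perp=\alpha$, $(A\otimes B)^\perp=A^\perp⅋B^\perp$, $(A⅋B)^\perp=A^\perp\otimes B^\perp$, $(\mathsf M^+_aA)^\perp=\mathsf M^-_a(A^\perp)$, $(\mathsf M^-_aA)^\perp=\mathsf M^+_a(A^\perp)$, and $A\multimap B:=A^\perp⅋B$. "Provable in MLL" means derivable in the one-sided sequent calculus using only axiom $\vdash A^\perp,A$ (any formula $A$, possibly with modalities), cut, $\otimes$ and $⅋$ rules, without the modality introduction rules. An instantiation substitutes formulas for propositional variables. Asynchronous translation: $\lfloor 1\rfloor = \alpha^\perp⅋\alpha$, $\lfloor P\parallel Q\rfloor = \lfloor P\rfloor\otimes\lfloor Q\rfloor$, $\lfloor a.P\rfloor = \mathsf M^+_a\alpha^\perp⅋(\lfloor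 P\rfloor\otimes\alpha)$, $\lfloor \bar a.P\rfloor = (\lfloor P\rfloor\otimes\alpha^\perp)⅋\mathsf M^-_a\alpha$, where in each clause $\alpha$ is a fresh propositional variable. -}

module Defs where

open import Data.Nat using (ℕ; suc)
open import Data.Product using (_×_; _,_; proj₁; ∃; ∃-syntax; Σ-syntax)
open import Data.List using (List; []; _∷_; _++_)
open import Data.List.Relation.Binary.Permutation.Propositional using (_↭_)

Chan : Set
Chan = ℕ

PVar : Set
PVar = ℕ

infixr 6 _∥_
data Term : Set where
  𝟙    : Term
  _∥_  : Term → Term → Term
  inp  : Chan → Term → Term
  out  : Chan → Term → Term

infix 4 _≡ₛ_
data _≡ₛ_ : Term → Term → Set where
  refl   : ∀ {P} → P ≡ₛ P
  sym    : ∀ {P Q} → P ≡ₛ Q → Q ≡ₛ P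
  trans  : ∀ {P Q R} → P ≡ₛ Q → Q ≡ₛ R → P ≡ₛ R
  par    : ∀ {P P' Q Q'} → P ≡ₛ P' → Q ≡ₛ Q' → (P ∥ Q) ≡ₛ (P' ∥ Q')
  inpc   : ∀ {a P P'} → P ≡ₛ P' → inp a P ≡ₛ inp a P'
  outc   : ∀ {a P P'} → P ≡ₛ P' → out a P ≡ₛ out a P'
  assoc  : ∀ {P Q R} → ((P ∥ Q) ∥ R) ≡ₛ (P ∥ (Q ∥ R))
  comm   : ∀ {P Q} → (P ∥ Q) ≡ₛ (Q ∥ P)
  unit   : ∀ {P} → (P ∥ 𝟙) ≡ₛ P

infix 4 _⟶_
_⟶_ : Term → Term → Set
P ⟶ Q = ∃[ a ] ∃[ P₁ ] ∃[ Q₁ ] ∃[ R ]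
          (P ≡ₛ ((out a P₁ ∥ inp a Q₁) ∥ R)) × (Q ≡ₛ ((P₁ ∥ Q₁) ∥ R))

infixr 7 _⊗_
infixr 6 _⅋_
data Formula : Set where
  var  : PVar → Formula
  nvar : PVar → Formula
  _⊗_  : Formula → Formula → Formula
  _⅋_  : Formula → Formula → Formula
  M⁺   : Chan → Formula → Formula
  M⁻   : Chan → Formula → Formula

infix 9 _^⊥
_^⊥ : Formula → Formula
var x ^⊥ = nvar x
nvar x ^⊥ = var x
(A ⊗ B) ^⊥ = (A ^⊥) ⅋ (B ^⊥)
(A ⅋ B) ^⊥ = (A ^⊥) ⊗ (B ^⊥)
M⁺ a A ^⊥ = M⁻ a (A ^⊥)
M⁻ a A ^⊥ = M⁺ a (A ^⊥)

infixr 5 _⊸_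
_⊸_ : Formula → Formula → Formula
A ⊸ B = (A ^⊥) ⅋ B

inst : (PVar → Formula) → Formula → Formula
inst σ (var x) = σ x
inst σ (nvar x) = (σ x) ^⊥
inst σ (A ⊗ B) = inst σ A ⊗ inst σ B
inst σ (A ⅋ B) = inst σ A ⅋ inst σ B
inst σ (M⁺ a A) = M⁺ a (inst σ A)
inst σ (M⁻ a A) = M⁻ a (inst σ A)

infix 3 ⊢_
data ⊢_ : List Formula → Set where
  ax   : ∀ A → ⊢ (A ^⊥ ∷ A ∷ [])
  ex   : ∀ {Γ Δ} → Γ ↭ Δ → ⊢ Γ → ⊢ Δ
  cut  : ∀ {Γ Δ A} → ⊢ (A ∷ Γ) → ⊢ (A ^⊥ ∷ Δ) → ⊢ (Γ ++ Δ)
  ⊗R   : ∀ {Γ Δ A B} → ⊢ (A ∷ Γ) → ⊢ (B ∷ Δ) → ⊢ ((A ⊗ B) ∷ Γ ++ Δ)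
  ⅋R   : ∀ {Γ A B} → ⊢ (A ∷ B ∷ Γ) → ⊢ ((A ⅋ B) ∷ Γ)

-- Asynchronous translation, with fresh variables drawn from a counter.
-- tr P n = (formula, next unused variable); all variables used are
-- pairwise distinct (each clause uses a new one).

tr : Term → ℕ → Formula × ℕ
tr 𝟙 n = (nvar n ⅋ var n) , suc n
tr (P ∥ Q) n with tr P n
... | F , m with tr Q m
... | G , k = (F ⊗ G) , k
tr (inp a P) n with tr P (suc n)
... | F , m = (M⁺ a (nvar n) ⅋ (F ⊗ var n)) , m
tr (out a P) n with tr P (suc n)
... | F , m = ((F ⊗ nvar n) ⅋ M⁻ a (var n)) , m

⌊_⌋ : Term → Formula
⌊ P ⌋ = proj₁ (tr P 0)

-- Translations of structurally congruent terms entail one another up to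
-- instantiation: ⊗ is associative and commutative for entailment, and a
-- unit α⊥ ⅋ α is absorbed once α is instantiated by the formula it sits
-- next to.  Since every clause of the translation uses a fresh variable,
-- instantiations chosen for disjoint subterms can be glued.  For the
-- redex ā.P ∥ a.Q, with A, B instances of ⌊P⌋, ⌊Q⌋, instantiating both
-- fresh variables by A makes the modalities dual, so a cut on them leaves
-- (A ⊗ A⊥) ⅋ (B ⊗ A), which entails A ⊗ B.
module Submission where

open import Defs
open import Data.Product using (∃-syntax; _,_; proj₁; proj₂; _×_)
open import Data.List using (_∷_; []; map; _++_)
open import Data.Nat using (ℕ; suc; _≤_; _<_)
open import Data.Nat.Properties using (≤-refl; ≤-trans; <-≤-trans; n≤1+n; n<1+n; <⇒≱; _<?_)
open import Data.Empty using (⊥-elim)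
open import Relation.Nullary using (yes; no)
open import Relation.Binary.PropositionalEquality using (_≡_; cong; cong₂; subst; subst₂) renaming (sym to ≡-sym; refl to ≡-refl)
open import Data.List.Relation.Binary.Permutation.Propositional using (prep; swap) renaming (refl to ↭-refl)
open import Data.List.Relation.Binary.Permutation.Propositional.Properties using (map⁺; ∷↭∷ʳ)
open import Data.List.Properties using (map-++)

^⊥-involutive : ∀ A → A ^⊥ ^⊥ ≡ A
^⊥-involutive (var x) = ≡-refl
^⊥-involutive (nvar x) = ≡-refl
^⊥-involutive (A ⊗ B) = cong₂ _⊗_ (^⊥-involutive A) (^⊥-involutive B)
^⊥-involutive (A ⅋ B) = cong₂ _⅋_ (^⊥-involutive A) (^⊥-involutive B)
^⊥-involutive (M⁺ a A) = cong (M⁺ a) (^⊥-involutive A)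
^⊥-involutive (M⁻ a A) = cong (M⁻ a) (^⊥-involutive A)

inst-^⊥ : ∀ σ A → inst σ (A ^⊥) ≡ inst σ A ^⊥
inst-^⊥ σ (var x) = ≡-refl
inst-^⊥ σ (nvar x) = ≡-sym (^⊥-involutive (σ x))
inst-^⊥ σ (A ⊗ B) = cong₂ _⅋_ (inst-^⊥ σ A) (inst-^⊥ σ B)
inst-^⊥ σ (A ⅋ B) = cong₂ _⊗_ (inst-^⊥ σ A) (inst-^⊥ σ B)
inst-^⊥ σ (M⁺ a A) = cong (M⁻ a) (inst-^⊥ σ A)
inst-^⊥ σ (M⁻ a A) = cong (M⁺ a) (inst-^⊥ σ A)

inst-∘ : ∀ σ τ A → inst τ (inst σ A) ≡ inst (λ x → inst τ (σ x)) A
inst-∘ σ τ (var x) = ≡-refl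
inst-∘ σ τ (nvar x) = inst-^⊥ τ (σ x)
inst-∘ σ τ (A ⊗ B) = cong₂ _⊗_ (inst-∘ σ τ A) (inst-∘ σ τ B)
inst-∘ σ τ (A ⅋ B) = cong₂ _⅋_ (inst-∘ σ τ A) (inst-∘ σ τ B)
inst-∘ σ τ (M⁺ a A) = cong (M⁺ a) (inst-∘ σ τ A)
inst-∘ σ τ (M⁻ a A) = cong (M⁻ a) (inst-∘ σ τ A)

⊢-inst : ∀ σ {Γ} → ⊢ Γ → ⊢ map (inst σ) Γ
⊢-inst σ (ax A) = subst (λ Z → ⊢ (Z ∷ inst σ A ∷ [])) (≡-sym (inst-^⊥ σ A)) (ax (inst σ A))
⊢-inst σ (ex p d) = ex (map⁺ (inst σ) p) (⊢-inst σ d)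
⊢-inst σ (cut {Γ} {Δ} {A} d e) =
  subst ⊢_ (≡-sym (map-++ (inst σ) Γ Δ))
    (cut (⊢-inst σ d) (subst (λ Z → ⊢ (Z ∷ map (inst σ) Δ)) (inst-^⊥ σ A) (⊢-inst σ e)))
⊢-inst σ (⊗R {Γ} {Δ} d e) =
  subst (λ L → ⊢ (_ ∷ L)) (≡-sym (map-++ (inst σ) Γ Δ)) (⊗R (⊢-inst σ d) (⊢-inst σ e))
⊢-inst σ (⅋R d) = ⅋R (⊢-inst σ d)

infix 2 _⊩_
_⊩_ : Formula → Formula → Set
A ⊩ B = ⊢ (A ^⊥ ∷ B ∷ [])

⊢-swap : ∀ {A B Γ} → ⊢ (A ∷ B ∷ Γ) → ⊢ (B ∷ A ∷ Γ)
⊢-swap {A} {B} = ex (swap A B ↭-refl)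

⊢-rotate : ∀ {A Γ} → ⊢ (A ∷ Γ) → ⊢ (Γ ++ A ∷ [])
⊢-rotate {A} {Γ} = ex (∷↭∷ʳ A Γ)

ax′ : ∀ A → ⊢ (A ∷ A ^⊥ ∷ [])
ax′ A = ⊢-swap (ax A)

⊩-refl : ∀ {A} → A ⊩ A
⊩-refl {A} = ax A

⊩-trans : ∀ {A B C} → A ⊩ B → B ⊩ C → A ⊩ C
⊩-trans d e = cut (⊢-swap d) e

⊩-inst : ∀ σ {A B} → A ⊩ B → inst σ A ⊩ inst σ B
⊩-inst σ {A} {B} d = subst (λ Z → ⊢ (Z ∷ inst σ B ∷ [])) (inst-^⊥ σ A) (⊢-inst σ d)

⊗-mono : ∀ {A B C D} → A ⊩ B → C ⊩ D → A ⊗ C ⊩ B ⊗ D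
⊗-mono d e = ⅋R (⊢-rotate (⊗R (⊢-swap d) (⊢-swap e)))

⅋-mono : ∀ {A B C D} → A ⊩ B → C ⊩ D → A ⅋ C ⊩ B ⅋ D
⅋-mono d e = ⊢-swap (⅋R (⊢-rotate (⊗R d e)))

⊗-assoc : ∀ {A B C} → (A ⊗ B) ⊗ C ⊩ A ⊗ (B ⊗ C)
⊗-assoc {A} {B} {C} = ⅋R (⅋R (⊢-rotate (⊗R (ax′ A) (⊗R (ax′ B) (ax′ C)))))

⊗-comm : ∀ {A B} → A ⊗ B ⊩ B ⊗ A
⊗-comm {A} {B} = ⅋R (⊢-swap (⊢-rotate (⊗R (ax′ B) (ax′ A))))

⊗-assoc⁻¹ : ∀ {A B C} → A ⊗ (B ⊗ C) ⊩ (A ⊗ B) ⊗ C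
⊗-assoc⁻¹ = ⊩-trans ⊗-comm (⊩-trans ⊗-assoc (⊩-trans ⊗-comm (⊩-trans ⊗-assoc ⊗-comm)))

⊗-identity-intro : ∀ {A B} → A ⊩ A ⊗ (B ⊸ B)
⊗-identity-intro {A} {B} = ⊢-swap (⊗R (ax′ A) (⅋R (ax B)))

⊗-identity-absorb : ∀ {A C} → C ⊩ A → C ⊗ (A ⊸ A) ⊩ A
⊗-identity-absorb {A} {C} d =
  subst (λ Z → ⊢ ((C ^⊥ ⅋ (Z ⊗ A ^⊥)) ∷ A ∷ [])) (≡-sym (^⊥-involutive A))
    (⅋R (⊢-swap (⊗R (⊢-swap d) (ax A))))

⅋-⊸-cut : ∀ {C D E} → (C ⅋ D) ⊗ (D ⊸ E) ⊩ C ⅋ E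
⅋-⊸-cut {C} {D} {E} =
  subst (λ Z → ⊢ ((C ^⊥ ⊗ D ^⊥) ⅋ (Z ⊗ E ^⊥) ∷ (C ⅋ E) ∷ [])) (≡-sym (^⊥-involutive D))
    (⅋R (⊢-rotate (⅋R (ex (prep C (prep E (swap _ _ ↭-refl)))
      (⊢-rotate (⊗R (ax C) (⊢-rotate (⊗R (ax′ D) (ax E)))))))))

⅋-⊗-release : ∀ {A B} → (A ⊗ A ^⊥) ⅋ (B ⊗ A) ⊩ A ⊗ B
⅋-⊗-release {A} {B} =
  ⊗R (⅋R (⊢-swap (ax (A ^⊥)))) (⅋R (⊢-swap (⊢-rotate (⊗R (ax′ A) (ax′ B)))))

trF : Term → ℕ → Formula
trN : Term → ℕ → ℕ
trF 𝟙 n = nvar n ⅋ var n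
trF (P ∥ Q) n = trF P n ⊗ trF Q (trN P n)
trF (inp a P) n = M⁺ a (nvar n) ⅋ (trF P (suc n) ⊗ var n)
trF (out a P) n = (trF P (suc n) ⊗ nvar n) ⅋ M⁻ a (var n)
trN 𝟙 n = suc n
trN (P ∥ Q) n = trN Q (trN P n)
trN (inp a P) n = trN P (suc n)
trN (out a P) n = trN P (suc n)

tr≡trF,trN : ∀ P n → tr P n ≡ (trF P n , trN P n)
tr≡trF,trN 𝟙 n = ≡-refl
tr≡trF,trN (P ∥ Q) n rewrite tr≡trF,trN P n | tr≡trF,trN Q (trN P n) = ≡-refl
tr≡trF,trN (inp a P) n rewrite tr≡trF,trN P (suc n) = ≡-refl
tr≡trF,trN (out a P) n rewrite tr≡trF,trN P (suc n) = ≡-refl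

n≤trN : ∀ P n → n ≤ trN P n
n≤trN 𝟙 n = n≤1+n n
n≤trN (P ∥ Q) n = ≤-trans (n≤trN P n) (n≤trN Q (trN P n))
n≤trN (inp a P) n = ≤-trans (n≤1+n n) (n≤trN P (suc n))
n≤trN (out a P) n = ≤-trans (n≤1+n n) (n≤trN P (suc n))

-- trF P n uses exactly the variables in [n, trN P n).
inst-trF-local : ∀ P n σ τ → (∀ x → n ≤ x → x < trN P n → σ x ≡ τ x) →
                 inst σ (trF P n) ≡ inst τ (trF P n)
inst-trF-local 𝟙 n σ τ h = let e = h n ≤-refl (n<1+n n) in cong₂ _⅋_ (cong _^⊥ e) e
inst-trF-local (P ∥ Q) n σ τ h =
  cong₂ _⊗_ (inst-trF-local P n σ τ (λ x p q → h x p (<-≤-trans q (n≤trN Q (trN P n)))))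
            (inst-trF-local Q (trN P n) σ τ (λ x p q → h x (≤-trans (n≤trN P n) p) q))
inst-trF-local (inp c P) n σ τ h =
  cong₂ (λ Y Z → M⁺ c (Y ^⊥) ⅋ (Z ⊗ Y))
    (h n ≤-refl (<-≤-trans (n<1+n n) (n≤trN P (suc n))))
    (inst-trF-local P (suc n) σ τ (λ x p q → h x (≤-trans (n≤1+n n) p) q))
inst-trF-local (out c P) n σ τ h =
  cong₂ (λ Y Z → (Z ⊗ Y ^⊥) ⅋ M⁻ c Y)
    (h n ≤-refl (<-≤-trans (n<1+n n) (n≤trN P (suc n))))
    (inst-trF-local P (suc n) σ τ (λ x p q → h x (≤-trans (n≤1+n n) p) q))

glue : ℕ → (PVar → Formula) → (PVar → Formula) → PVar → Formula
glue k σ τ x with x <? k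
... | yes _ = σ x
... | no _ = τ x

glue-below : ∀ {k σ τ x} → x < k → glue k σ τ x ≡ σ x
glue-below {k} {σ} {τ} {x} x<k with x <? k
... | yes _ = ≡-refl
... | no x≮k = ⊥-elim (x≮k x<k)

glue-above : ∀ {k σ τ x} → k ≤ x → glue k σ τ x ≡ τ x
glue-above {k} {σ} {τ} {x} k≤x with x <? k
... | yes x<k = ⊥-elim (<⇒≱ x<k k≤x)
... | no _ = ≡-refl

inst-glue-below : ∀ P n {σ τ} → inst (glue (trN P n) σ τ) (trF P n) ≡ inst σ (trF P n)
inst-glue-below P n = inst-trF-local P n _ _ (λ _ _ x<k → glue-below x<k)

inst-glue-above : ∀ P {k n σ τ} → k ≤ n → inst (glue k σ τ) (trF P n) ≡ inst τ (trF P n)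
inst-glue-above P {n = n} k≤n = inst-trF-local P n _ _ (λ _ n≤x _ → glue-above (≤-trans k≤n n≤x))

-- The quantification over the starting counter n makes the notion
-- independent of which fresh variables the translation happens to use.
infix 4 _⇝_
record _⇝_ (P : Term) (A : Formula) : Set where
  constructor mk
  field instance-at : ∀ n → ∃[ σ ] (inst σ (trF P n) ⊩ A)
open _⇝_

⇝-⊩ : ∀ {P A B} → P ⇝ A → A ⊩ B → P ⇝ B
⇝-⊩ s e = mk λ n → proj₁ (instance-at s n) , ⊩-trans (proj₂ (instance-at s n)) e

⇝-trans : ∀ {P Q B} k → P ⇝ trF Q k → Q ⇝ B → P ⇝ B
⇝-trans {P} {Q} {B} k s t = mk λ n →
  let (σ , d) = instance-at s n ; (τ , e) = instance-at t k in
  (λ x → inst τ (σ x)) , subst (_⊩ B) (inst-∘ σ τ (trF P n)) (⊩-trans (⊩-inst τ d) e)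

⇝-∥ : ∀ {P Q A B} → P ⇝ A → Q ⇝ B → P ∥ Q ⇝ A ⊗ B
⇝-∥ {P} {Q} {A} {B} s t = mk λ n →
  let k = trN P n ; (σ , d) = instance-at s n ; (τ , e) = instance-at t k in
  glue k σ τ ,
  subst₂ (λ X Y → X ⊗ Y ⊩ A ⊗ B)
    (≡-sym (inst-glue-below P n)) (≡-sym (inst-glue-above Q ≤-refl)) (⊗-mono d e)

⇝-inp : ∀ {a P A} X → P ⇝ A → inp a P ⇝ M⁺ a (X ^⊥) ⅋ (A ⊗ X)
⇝-inp {a} {P} {A} X s = mk λ n →
  let (σ , d) = instance-at s (suc n) in
  glue (suc n) (λ _ → X) σ ,
  subst₂ (λ Y Z → M⁺ a (Y ^⊥) ⅋ (Z ⊗ Y) ⊩ M⁺ a (X ^⊥) ⅋ (A ⊗ X))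
    (≡-sym (glue-below (n<1+n n))) (≡-sym (inst-glue-above P ≤-refl))
    (⅋-mono ⊩-refl (⊗-mono d ⊩-refl))

⇝-out : ∀ {a P A} X → P ⇝ A → out a P ⇝ (A ⊗ X ^⊥) ⅋ M⁻ a X
⇝-out {a} {P} {A} X s = mk λ n →
  let (σ , d) = instance-at s (suc n) in
  glue (suc n) (λ _ → X) σ ,
  subst₂ (λ Y Z → (Z ⊗ Y ^⊥) ⅋ M⁻ a Y ⊩ (A ⊗ X ^⊥) ⅋ M⁻ a X)
    (≡-sym (glue-below (n<1+n n))) (≡-sym (inst-glue-above P ≤-refl))
    (⅋-mono (⊗-mono d ⊩-refl) ⊩-refl)

⇝-𝟙 : ∀ B → 𝟙 ⇝ B ⊸ B
⇝-𝟙 B = mk λ _ → (λ _ → B) , ⊩-refl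

⇝-∥𝟙 : ∀ {P A} → P ⇝ A → P ∥ 𝟙 ⇝ A
⇝-∥𝟙 {P} {A} s = mk λ n →
  let k = trN P n ; (σ , d) = instance-at s n in
  glue k σ (λ _ → A) ,
  subst₂ (λ X Y → X ⊗ Y ⊩ A)
    (≡-sym (inst-glue-below P n)) (≡-sym (inst-glue-above 𝟙 {k} {k} {σ} ≤-refl))
    (⊗-identity-absorb d)

⇝-trF : ∀ P m → P ⇝ trF P m
⇝-trF 𝟙 m = ⇝-𝟙 (var m)
⇝-trF (P ∥ Q) m = ⇝-∥ (⇝-trF P m) (⇝-trF Q (trN P m))
⇝-trF (inp a P) m = ⇝-inp (var m) (⇝-trF P (suc m))
⇝-trF (out a P) m = ⇝-out (var m) (⇝-trF P (suc m))

infix 4 _≼_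
_≼_ : Term → Term → Set
P ≼ Q = ∀ m → P ⇝ trF Q m

≼-trans : ∀ {P Q R} → P ≼ Q → Q ≼ R → P ≼ R
≼-trans s t m = ⇝-trans 0 (s 0) (t m)

≼-∥ : ∀ {P P′ Q Q′} → P ≼ P′ → Q ≼ Q′ → P ∥ Q ≼ P′ ∥ Q′
≼-∥ {P′ = P′} s t m = ⇝-∥ (s m) (t (trN P′ m))

≼-inp : ∀ {a P P′} → P ≼ P′ → inp a P ≼ inp a P′
≼-inp s m = ⇝-inp (var m) (s (suc m))

≼-out : ∀ {a P P′} → P ≼ P′ → out a P ≼ out a P′
≼-out s m = ⇝-out (var m) (s (suc m))

≡ₛ⇒≼ : ∀ {P Q} → P ≡ₛ Q → P ≼ Q × Q ≼ P
≡ₛ⇒≼ {P} refl = ⇝-trF P , ⇝-trF P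
≡ₛ⇒≼ (sym e) = let (s , t) = ≡ₛ⇒≼ e in t , s
≡ₛ⇒≼ (trans e f) =
  let (s , s′) = ≡ₛ⇒≼ e ; (t , t′) = ≡ₛ⇒≼ f in ≼-trans s t , ≼-trans t′ s′
≡ₛ⇒≼ (par e f) =
  let (s , s′) = ≡ₛ⇒≼ e ; (t , t′) = ≡ₛ⇒≼ f in ≼-∥ s t , ≼-∥ s′ t′
≡ₛ⇒≼ (inpc e) = let (s , s′) = ≡ₛ⇒≼ e in ≼-inp s , ≼-inp s′
≡ₛ⇒≼ (outc e) = let (s , s′) = ≡ₛ⇒≼ e in ≼-out s , ≼-out s′
≡ₛ⇒≼ (assoc {P} {Q} {R}) =
  (λ m → ⇝-⊩ (⇝-trF ((P ∥ Q) ∥ R) m) ⊗-assoc) ,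
  (λ m → ⇝-⊩ (⇝-trF (P ∥ (Q ∥ R)) m) ⊗-assoc⁻¹)
≡ₛ⇒≼ (comm {P} {Q}) =
  (λ m → ⇝-⊩ (⇝-∥ (⇝-trF P (trN Q m)) (⇝-trF Q m)) ⊗-comm) ,
  (λ m → ⇝-⊩ (⇝-∥ (⇝-trF Q (trN P m)) (⇝-trF P m)) ⊗-comm)
≡ₛ⇒≼ (unit {P}) =
  (λ m → ⇝-∥𝟙 (⇝-trF P m)) ,
  (λ m → ⇝-⊩ (⇝-trF P m) ⊗-identity-intro)

-- Both fresh variables are instantiated by A, so that M⁻ a A and
-- M⁺ a (A ^⊥) are dual and can be cut against each other.
⇝-communicate : ∀ {a P Q A B} → P ⇝ A → Q ⇝ B → out a P ∥ inp a Q ⇝ A ⊗ B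
⇝-communicate {A = A} s t =
  ⇝-⊩ (⇝-∥ (⇝-out A s) (⇝-inp A t)) (⊩-trans ⅋-⊸-cut ⅋-⊗-release)

⟶⇒≼ : ∀ {P Q} → P ⟶ Q → P ≼ Q
⟶⇒≼ (a , P₁ , Q₁ , R , P≡redex , Q≡reduct) =
  ≼-trans (proj₁ (≡ₛ⇒≼ P≡redex)) (≼-trans redex≼reduct (proj₂ (≡ₛ⇒≼ Q≡reduct)))
  where
  redex≼reduct : (out a P₁ ∥ inp a Q₁) ∥ R ≼ (P₁ ∥ Q₁) ∥ R
  redex≼reduct m =
    ⇝-∥ (⇝-communicate (⇝-trF P₁ m) (⇝-trF Q₁ (trN P₁ m))) (⇝-trF R (trN Q₁ (trN P₁ m)))

proposition13 : ∀ P Q → P ⟶ Q → ∃[ σ ] (⊢ (inst σ ⌊ P ⌋ ⊸ ⌊ Q ⌋) ∷ [])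
proposition13 P Q r =
  let (σ , d) = instance-at (⟶⇒≼ r 0) 0 in
  σ , subst₂ (λ X Y → ⊢ (inst σ X ⊸ Y) ∷ [])
        (≡-sym (cong proj₁ (tr≡trF,trN P 0))) (≡-sym (cong proj₁ (tr≡trF,trN Q 0))) (⅋R d)
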